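{- Let $m\ge1$, let $\{a_n\}_{n\ge0}$ be the $m$-gonal sequence, and for $n,k\ge0$ let $p_{n,k}$ be the number of integers in $[0,a_{mn+1})$ whose legal $m$-gonal decomposition has exactly $k$ summands. Then \[ p_{n,k}=\begin{cases}1 & \text{if } k=0,\\ m^k\binom{n}{k}+m^{k-1}\binom{n}{k-1} & \text{if } 1\le k\le n+1,\\ 0 & \text{if } k>n+1.\end{cases} \]
   Context: Bins of an increasing sequence $\{a_n\}_{n\ge0}$: $b_0=[a_0]$, $b_k=[a_{m(k-1)+1},\dots,a_{mk}]$ for $k\ge1$. A legal $m$-gonal decomposition of $z$ is $z=a_{\ell_t}+\cdots+a_{\ell_1}$ with $\ell_1<\cdots<\ell_t$ and no two summands in the same bin ($0$ has the empty decomposition). The $m$-gonal sequence: each $a_i$ is the smallest positive integer with no legal $m$-gonal decomposition using only $a_0,\dots,a_{i-1}$. Every nonnegative integer has a unique legal $m$-gonal decomposition in terms of this sequence. Here $\binom{n}{n+1}=0$. -}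

module Defs where

open import Data.Nat using (ℕ; zero; suc; _+_; _*_; _∸_; _≤_; _<_)
open import Data.List using (List; map; length)
open import Data.Nat.ListAction using (sum)
open import Data.List.Relation.Unary.All using (All)
open import Data.List.Relation.Unary.AllPairs using (AllPairs)
open import Data.Product using (Σ; ∃; _×_)
open import Data.Sum using (_⊎_)
open import Relation.Binary.PropositionalEquality using (_≡_)
open import Relation.Nullary using (¬_)

-- InBin m i k : the index i lies in bin b_k, where
--   b_0 = [a_0],  b_k = [a_{m(k-1)+1}, ..., a_{mk}]  (k ≥ 1).
InBin : ℕ → ℕ → ℕ → Set
InBin m i k = (i ≡ 0 × k ≡ 0) ⊎ (1 ≤ k × (m * (k ∸ 1) + 1 ≤ i × i ≤ m * k))

SameBin : ℕ → ℕ → ℕ → Set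
SameBin m i j = ∃ λ k → InBin m i k × InBin m j k

Legal : ℕ → List ℕ → Set
Legal m ℓ = AllPairs _<_ ℓ × AllPairs (λ i j → ¬ SameBin m i j) ℓ

value : (ℕ → ℕ) → List ℕ → ℕ
value a ℓ = sum (map a ℓ)

HasLegalDecompUsing : ℕ → (ℕ → ℕ) → ℕ → ℕ → Set
HasLegalDecompUsing m a i z =
  Σ (List ℕ) λ ℓ → Legal m ℓ × All (_< i) ℓ × value a ℓ ≡ z

IsMGonal : ℕ → (ℕ → ℕ) → Set
IsMGonal m a = ∀ i →
  (0 < a i) × (¬ HasLegalDecompUsing m a i (a i))
  × (∀ y → 0 < y → y < a i → HasLegalDecompUsing m a i y)

-- z's legal m-gonal decomposition (w.r.t. the whole sequence a) has exactly
-- k summands (the decomposition is unique, so "some" = "the").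
DecompHasSummands : ℕ → (ℕ → ℕ) → ℕ → ℕ → Set
DecompHasSummands m a k z =
  Σ (List ℕ) λ ℓ → Legal m ℓ × length ℓ ≡ k × value a ℓ ≡ z

module Submission where

-- Write N k = 2(m+1)^k (defined recursively below).  Call a legal decomposition
-- "supported below i" if all its indices are ≤ i.  Since the indices
-- mk+1, …, mk+m form the single bin b_{k+1}, a legal decomposition supported
-- below mk+j+1 (j < m) either is supported below mk+j, or is one supported below
-- mk followed by the new index mk+j+1 ('peel-top').  Hence the list
--   Enum 0 = [ [] , [0] ],   Enum (k+1) = Enum k ++ (Enum k ⌢ mk+1) ++ … ++ (Enum k ⌢ mk+m)
-- enumerates exactly the legal decompositions supported below mk ('Enumeration').
-- Since a_i is the least positive integer without a legal decomposition using
-- indices < i ('a-mex'), an induction shows that the values of Enum k are exactly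
-- 0, 1, …, N k − 1 in order and that a_{mk+j} = j · N k ('MGonal').  Counting the
-- members of Enum k by length gives c(n+1, s+1) = c(n, s+1) + m · c(n, s), which
-- is Pascal's recurrence for p_{n,k} ('Counting').  Finally a is increasing, so a
-- decomposition of z < a_{mn+1} only uses indices ≤ mn, and the values of the
-- members of Enum n with k summands form the required duplicate-free list.

open import Defs
open import Data.Nat using (ℕ; zero; suc; _+_; _*_; _∸_; _^_; _≤_; _<_; z≤n; s≤s; _≤′_; ≤′-refl; ≤′-step; _≟_; _≤?_)
open import Data.Nat.Properties
open import Data.Nat.Combinatorics using (_C_; k>n⇒nCk≡0; nCk+nC[k+1]≡[n+1]C[k+1])
open import Data.Nat.ListAction using (sum)
open import Data.Nat.ListAction.Properties using (sum-++)
open import Data.Nat.Solver using (module +-*-Solver)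
open import Data.List using (List; []; _∷_; _++_; _∷ʳ_; [_]; map; length; filter; applyUpTo; upTo)
open import Data.List.Base using (InitLast; initLast)
open import Data.List.Properties using (map-++; map-∘; map-cong; map-upTo; length-++; length-map; filter-++)
open import Data.List.Relation.Unary.All as All using (All; []; _∷_)
import Data.List.Relation.Unary.All.Properties as AllP
open import Data.List.Relation.Unary.AllPairs using (AllPairs; []; _∷_)
import Data.List.Relation.Unary.AllPairs.Properties as AllPairsP
open import Data.List.Relation.Unary.Any using (here; there)
open import Data.List.Relation.Unary.Unique.Propositional using (Unique)
open import Data.List.Relation.Unary.Unique.Propositional.Properties using (upTo⁺)
open import Data.List.Membership.Propositional using (_∈_)
open import Data.List.Membership.Propositional.Properties
  using (∈-map⁺; ∈-map⁻; ∈-++⁺ˡ; ∈-++⁺ʳ; ∈-++⁻; ∈-upTo⁺; ∈-upTo⁻; ∈-filter⁺; ∈-filter⁻)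
open import Data.Product using (Σ; ∃; _×_; _,_; proj₁; proj₂)
open import Data.Sum using (_⊎_; inj₁; inj₂)
open import Data.Empty using (⊥-elim)
open import Data.Bool using (true; false)
open import Function using (_∘_; id)
open import Function.Bundles using (_⇔_; mk⇔; Equivalence)
open import Relation.Binary using (tri<; tri≈; tri>)
open import Relation.Binary.PropositionalEquality using (_≡_; refl; sym; trans; cong; cong₂; subst; module ≡-Reasoning)
open import Relation.Nullary using (¬_; does; yes; no)

open Equivalence using (to; from)
open InitLast using ([]; _∷ʳ′_)

allPairs-∷ʳ⁺ : ∀ {A : Set} {R : A → A → Set} {xs x} →
               AllPairs R xs → All (λ y → R y x) xs → AllPairs R (xs ∷ʳ x)
allPairs-∷ʳ⁺ pairs toX = AllPairsP.++⁺ pairs ([] ∷ []) (All.map (_∷ []) toX)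

allPairs-∷ʳ⁻ : ∀ {A : Set} {R : A → A → Set} {xs x} →
               AllPairs R (xs ∷ʳ x) → AllPairs R xs × All (λ y → R y x) xs
allPairs-∷ʳ⁻ {xs = []} _ = [] , []
allPairs-∷ʳ⁻ {xs = y ∷ xs} (fromY ∷ pairs) =
  let pairs′ , toX = allPairs-∷ʳ⁻ pairs
  in  (AllP.++⁻ˡ xs fromY ∷ pairs′) , (All.head (AllP.++⁻ʳ xs fromY) ∷ toX)

applyUpTo-+ : ∀ {A : Set} (f : ℕ → A) p q →
              applyUpTo f (p + q) ≡ applyUpTo f p ++ applyUpTo (λ i → f (p + i)) q
applyUpTo-+ f zero q = refl
applyUpTo-+ f (suc p) q = cong (f 0 ∷_) (applyUpTo-+ (f ∘ suc) p q)

∈⇒≤sum : ∀ {n ns} → n ∈ ns → n ≤ sum ns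
∈⇒≤sum {ns = n ∷ ns} (here refl) = m≤m+n n (sum ns)
∈⇒≤sum {ns = x ∷ ns} (there n∈ns) = ≤-trans (∈⇒≤sum n∈ns) (m≤n+m (sum ns) x)

module Bins (m : ℕ) where

  inBin-upper : ∀ {i b} → InBin m i b → i ≤ m * b
  inBin-upper (inj₁ (refl , refl)) = z≤n
  inBin-upper (inj₂ (_ , _ , i≤mb)) = i≤mb

  inBin-lower : ∀ {i b} → InBin m i (suc b) → m * b < i
  inBin-lower (inj₁ (_ , ()))
  inBin-lower {i} {b} (inj₂ (_ , mb+1≤i , _)) = subst (_≤ i) (+-comm (m * b) 1) mb+1≤i

  inBin-block : ∀ {i k} → m * k < i → i ≤ m * suc k → InBin m i (suc k)
  inBin-block {i} {k} mk<i i≤ = inj₂ (s≤s z≤n , subst (_≤ i) (+-comm 1 (m * k)) mk<i , i≤)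

  block-end : ∀ k → m * k + m ≡ m * suc k
  block-end k = trans (+-comm (m * k) m) (sym (*-suc m k))

  separated : ∀ {k y x} → y ≤ m * k → m * k < x → ¬ SameBin m y x
  separated {k} {y} y≤mk mk<x (b , y∈b , x∈b) = apart (*-cancelˡ-< m k b (<-≤-trans mk<x (inBin-upper x∈b))) y∈b
    where
      -- x forces the common bin beyond b_k, where y cannot lie.
      apart : ∀ {b} → k < b → ¬ InBin m y b
      apart {suc b} (s≤s k≤b) y∈b = <⇒≱ (*-cancelˡ-< m b k (<-≤-trans (inBin-lower y∈b) y≤mk)) k≤b

  LegalBelow : ℕ → List ℕ → Set
  LegalBelow i ℓ = Legal m ℓ × All (_≤ i) ℓ

  below-mono : ∀ {i i′ ℓ} → i ≤ i′ → LegalBelow i ℓ → LegalBelow i′ ℓ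
  below-mono i≤i′ (legal , below) = legal , All.map (λ y≤i → ≤-trans y≤i i≤i′) below

  extend-legal : ∀ {k x ℓ} → LegalBelow (m * k) ℓ → m * k < x → LegalBelow x (ℓ ∷ʳ x)
  extend-legal (legal , below) mk<x =
    ( allPairs-∷ʳ⁺ (proj₁ legal) (All.map (λ y≤mk → ≤-<-trans y≤mk mk<x) below)
    , allPairs-∷ʳ⁺ (proj₂ legal) (All.map (λ y≤mk → separated y≤mk mk<x) below) )
    , AllP.++⁺ (All.map (λ y≤mk → ≤-trans y≤mk (<⇒≤ mk<x)) below) (≤-refl ∷ [])

  -- As m·k+1, …, m·k+j+1 lie in one bin (j < m), a legal decomposition supported
  -- below m·k+j+1 either avoids m·k+j+1 or is one supported below m·k followed by it.
  peel-top : ∀ {k j ℓ} → suc j ≤ m → LegalBelow (m * k + suc j) ℓ →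
             All (_≤ m * k + j) ℓ ⊎ ∃ λ ℓ′ → ℓ ≡ ℓ′ ∷ʳ (m * k + suc j) × LegalBelow (m * k) ℓ′
  peel-top {k} {j} {ℓ} j<m (legal , below) with initLast ℓ
  ... | [] = inj₁ []
  ... | ℓ′ ∷ʳ′ x with allPairs-∷ʳ⁻ (proj₁ legal) | allPairs-∷ʳ⁻ (proj₂ legal) | AllP.++⁻ ℓ′ below
  ...   | increasing , ℓ′<x | inDistinctBins , ℓ′∤x | _ , (x≤top ∷ []) with x ≤? m * k + j
  ...     | yes x≤mkj = inj₁ (AllP.++⁺ (All.map (λ y<x → <⇒≤ (<-≤-trans y<x x≤mkj)) ℓ′<x) (x≤mkj ∷ []))
  ...     | no x≰mkj = inj₂ (ℓ′ , cong (ℓ′ ∷ʳ_) x≡top , (increasing , inDistinctBins) ,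
                             All.zipWith below-block (ℓ′<x , ℓ′∤x))
    where
      mk<x : m * k < x
      mk<x = ≤-<-trans (m≤m+n (m * k) j) (≰⇒> x≰mkj)
      x≡top : x ≡ m * k + suc j
      x≡top = ≤-antisym x≤top (subst (_≤ x) (sym (+-suc (m * k) j)) (≰⇒> x≰mkj))
      x≤block : x ≤ m * suc k
      x≤block = ≤-trans x≤top (subst (m * k + suc j ≤_) (block-end k) (+-monoʳ-≤ (m * k) j<m))
      below-block : ∀ {y} → y < x × ¬ SameBin m y x → y ≤ m * k
      below-block (y<x , y∤x) = ≮⇒≥ λ mk<y →
        y∤x (suc k , inBin-block mk<y (≤-trans (<⇒≤ y<x) x≤block) , inBin-block mk<x x≤block)

module Enumeration (m : ℕ) where
  open Bins m

  record Enumerates (i : ℕ) (E : List (List ℕ)) : Set where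
    field
      sound    : ∀ {ℓ} → ℓ ∈ E → LegalBelow i ℓ
      complete : ∀ {ℓ} → LegalBelow i ℓ → ℓ ∈ E
  open Enumerates public

  extend : ℕ → ℕ → List (List ℕ) → List (List ℕ)
  extend k zero E = E
  extend k (suc j) E = extend k j E ++ map (_∷ʳ (m * k + suc j)) E

  Enum : ℕ → List (List ℕ)
  Enum zero = [] ∷ [ 0 ] ∷ []
  Enum (suc k) = extend k m (Enum k)

  -- 'peel-top' shows that extending one step at a time misses nothing.
  extend-enumerates : ∀ {k E} j → j ≤ m → Enumerates (m * k) E → Enumerates (m * k + j) (extend k j E)
  extend-enumerates {k} {E} j j≤m E-enum = record { sound = extend-sound j ; complete = extend-complete j j≤m }
    where
      extend-sound : ∀ j {ℓ} → ℓ ∈ extend k j E → LegalBelow (m * k + j) ℓ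
      extend-sound zero ℓ∈E = below-mono (m≤m+n (m * k) 0) (sound E-enum ℓ∈E)
      extend-sound (suc j) ℓ∈ with ∈-++⁻ (extend k j E) ℓ∈
      ... | inj₁ ℓ∈old = below-mono (+-monoʳ-≤ (m * k) (n≤1+n j)) (extend-sound j ℓ∈old)
      ... | inj₂ ℓ∈new with ∈-map⁻ (_∷ʳ (m * k + suc j)) ℓ∈new
      ...   | ℓ′ , ℓ′∈E , refl = extend-legal (sound E-enum ℓ′∈E) (m<m+n (m * k) (s≤s z≤n))

      extend-complete : ∀ j {ℓ} → j ≤ m → LegalBelow (m * k + j) ℓ → ℓ ∈ extend k j E
      extend-complete zero _ ℓ-below = complete E-enum (below-mono (≤-reflexive (+-identityʳ (m * k))) ℓ-below)
      extend-complete (suc j) j<m ℓ-below with peel-top j<m ℓ-below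
      ... | inj₁ below = ∈-++⁺ˡ (extend-complete j (<⇒≤ j<m) (proj₁ ℓ-below , below))
      ... | inj₂ (ℓ′ , refl , ℓ′-below) = ∈-++⁺ʳ (extend k j E) (∈-map⁺ (_∷ʳ (m * k + suc j)) (complete E-enum ℓ′-below))

  enum-zero-enumerates : Enumerates 0 (Enum 0)
  enum-zero-enumerates = record { sound = base-sound ; complete = base-complete }
    where
      base-sound : ∀ {ℓ} → ℓ ∈ Enum 0 → LegalBelow 0 ℓ
      base-sound (here refl) = ([] , []) , []
      base-sound (there (here refl)) = ([] ∷ [] , [] ∷ []) , (z≤n ∷ [])

      base-complete : ∀ {ℓ} → LegalBelow 0 ℓ → ℓ ∈ Enum 0
      base-complete {[]} _ = here refl
      base-complete {_ ∷ []} (_ , (z≤n ∷ [])) = there (here refl)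
      base-complete {_ ∷ _ ∷ _} ((((() ∷ _) ∷ _) , _) , (z≤n ∷ z≤n ∷ _))

  enum-enumerates : ∀ k → Enumerates (m * k) (Enum k)
  enum-enumerates zero = subst (λ i → Enumerates i (Enum 0)) (sym (*-zeroʳ m)) enum-zero-enumerates
  enum-enumerates (suc k) = subst (λ i → Enumerates i (Enum (suc k))) (block-end k)
                                  (extend-enumerates m ≤-refl (enum-enumerates k))

module Counting (m : ℕ) where
  open Enumeration m
  open +-*-Solver

  ofLength : ℕ → List (List ℕ) → List (List ℕ)
  ofLength s = filter (λ ℓ → length ℓ ≟ s)

  count : ℕ → List (List ℕ) → ℕ
  count s E = length (ofLength s E)

  count-++ : ∀ s E F → count s (E ++ F) ≡ count s E + count s F
  count-++ s E F = trans (cong length (filter-++ (λ ℓ → length ℓ ≟ s) E F)) (length-++ (ofLength s E))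

  length-∷ʳ : ∀ (ℓ : List ℕ) x → length (ℓ ∷ʳ x) ≡ suc (length ℓ)
  length-∷ʳ ℓ x = trans (length-++ ℓ) (+-comm (length ℓ) 1)

  count-∷ʳ-zero : ∀ x E → count 0 (map (_∷ʳ x) E) ≡ 0
  count-∷ʳ-zero x [] = refl
  count-∷ʳ-zero x (ℓ ∷ E) rewrite length-∷ʳ ℓ x = count-∷ʳ-zero x E

  count-∷ʳ-suc : ∀ s x E → count (suc s) (map (_∷ʳ x) E) ≡ count s E
  count-∷ʳ-suc s x [] = refl
  count-∷ʳ-suc s x (ℓ ∷ E) rewrite length-∷ʳ ℓ x with does (length ℓ ≟ s)
  ... | true = cong suc (count-∷ʳ-suc s x E)
  ... | false = count-∷ʳ-suc s x E

  -- Each of the j extensions of E adds a copy of E with lengths shifted by one.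
  count-extend-zero : ∀ k j E → count 0 (extend k j E) ≡ count 0 E
  count-extend-zero k zero E = refl
  count-extend-zero k (suc j) E = begin
    count 0 (extend k j E ++ map (_∷ʳ (m * k + suc j)) E)
      ≡⟨ count-++ 0 (extend k j E) _ ⟩
    count 0 (extend k j E) + count 0 (map (_∷ʳ (m * k + suc j)) E)
      ≡⟨ cong₂ _+_ (count-extend-zero k j E) (count-∷ʳ-zero _ E) ⟩
    count 0 E + 0
      ≡⟨ +-identityʳ (count 0 E) ⟩
    count 0 E ∎
    where open ≡-Reasoning

  count-extend-suc : ∀ s k j E → count (suc s) (extend k j E) ≡ count (suc s) E + j * count s E
  count-extend-suc s k zero E = sym (+-identityʳ (count (suc s) E))
  count-extend-suc s k (suc j) E = begin
    count (suc s) (extend k j E ++ map (_∷ʳ (m * k + suc j)) E)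
      ≡⟨ count-++ (suc s) (extend k j E) _ ⟩
    count (suc s) (extend k j E) + count (suc s) (map (_∷ʳ (m * k + suc j)) E)
      ≡⟨ cong₂ _+_ (count-extend-suc s k j E) (count-∷ʳ-suc s _ E) ⟩
    (count (suc s) E + j * count s E) + count s E
      ≡⟨ solve 3 (λ c′ j c → (c′ :+ j :* c) :+ c := c′ :+ (c :+ j :* c)) refl (count (suc s) E) j (count s E) ⟩
    count (suc s) E + suc j * count s E ∎
    where open ≡-Reasoning

  p : ℕ → ℕ → ℕ
  p n zero = 1
  p n (suc k) = m ^ suc k * (n C suc k) + m ^ k * (n C k)

  -- Pascal's rule for the binomials gives p (n+1) (k+1) = p n (k+1) + m · p n k.
  p-step : ∀ n k → p n (suc k) + m * p n k ≡ p (suc n) (suc k)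
  p-step n zero rewrite sym (nCk+nC[k+1]≡[n+1]C[k+1] n 0) =
    solve 2 (λ m x → (m :* con 1) :* x :+ con 1 :* con 1 :+ m :* con 1
                  := (m :* con 1) :* (con 1 :+ x) :+ con 1 :* con 1) refl m (n C 1)
  p-step n (suc k)
    rewrite sym (nCk+nC[k+1]≡[n+1]C[k+1] n (suc k)) | sym (nCk+nC[k+1]≡[n+1]C[k+1] n k) =
    solve 5 (λ m q x y z → m :* (m :* q) :* x :+ m :* q :* y :+ m :* (m :* q :* y :+ q :* z)
                        := m :* (m :* q) :* (y :+ x) :+ m :* q :* (z :+ y))
            refl m (m ^ k) (n C suc (suc k)) (n C suc k) (n C k)

  count-enum : ∀ n s → count s (Enum n) ≡ p n s
  count-enum zero zero = refl
  count-enum zero (suc zero) = sym (cong (_+ 1) (*-zeroʳ (m ^ 1)))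
  count-enum zero (suc (suc s)) = sym (cong₂ _+_ (*-zeroʳ (m ^ suc (suc s))) (*-zeroʳ (m ^ suc s)))
  count-enum (suc n) zero = trans (count-extend-zero n m (Enum n)) (count-enum n zero)
  count-enum (suc n) (suc s) = begin
    count (suc s) (extend n m (Enum n))           ≡⟨ count-extend-suc s n m (Enum n) ⟩
    count (suc s) (Enum n) + m * count s (Enum n) ≡⟨ cong₂ (λ c c′ → c + m * c′) (count-enum n (suc s)) (count-enum n s) ⟩
    p n (suc s) + m * p n s                       ≡⟨ p-step n s ⟩
    p (suc n) (suc s) ∎
    where open ≡-Reasoning

  p-formula : ∀ n k → 1 ≤ k → p n k ≡ m ^ k * (n C k) + m ^ (k ∸ 1) * (n C (k ∸ 1))
  p-formula n (suc k) _ = refl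

  p-vanishes : ∀ n k → n + 1 < k → p n k ≡ 0
  p-vanishes n (suc k) (s≤s n+1≤k) =
    cong₂ _+_ (trans (cong (m ^ suc k *_) (k>n⇒nCk≡0 (m<n⇒m<1+n n<k))) (*-zeroʳ (m ^ suc k)))
              (trans (cong (m ^ k *_) (k>n⇒nCk≡0 n<k)) (*-zeroʳ (m ^ k)))
    where
      n<k : n < k
      n<k = subst (_≤ k) (+-comm n 1) n+1≤k

-- N k = 2(m+1)^k: the number of legal decompositions supported on b₀, …, b_k.
N : ℕ → ℕ → ℕ
N m zero = 2
N m (suc k) = suc m * N m k

module MGonal (m : ℕ) (a : ℕ → ℕ) (isMGonal : IsMGonal m a) where
  open Enumeration m
  open Counting m

  val : List ℕ → ℕ
  val = value a

  value-∷ʳ : ∀ ℓ x → val (ℓ ∷ʳ x) ≡ a x + val ℓ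
  value-∷ʳ ℓ x = begin
    sum (map a (ℓ ++ [ x ]))  ≡⟨ cong sum (map-++ a ℓ [ x ]) ⟩
    sum (map a ℓ ++ [ a x ]) ≡⟨ sum-++ (map a ℓ) [ a x ] ⟩
    val ℓ + (a x + 0)        ≡⟨ cong (val ℓ +_) (+-identityʳ (a x)) ⟩
    val ℓ + a x              ≡⟨ +-comm (val ℓ) (a x) ⟩
    a x + val ℓ ∎
    where open ≡-Reasoning

  a-mex : ∀ i c → (∀ z → HasLegalDecompUsing m a i z ⇔ z < c) → a i ≡ c
  a-mex i c realises with isMGonal i | <-cmp (a i) c
  ... | _ , undecomposable , _ | tri< ai<c _ _ = ⊥-elim (undecomposable (from (realises (a i)) ai<c))
  ... | _ | tri≈ _ ai≡c _ = ai≡c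
  ... | _ , _ , minimal | tri> _ _ c<ai = ⊥-elim (<-irrefl refl (to (realises c) (minimal c 0<c c<ai)))
    where
      0<c : 0 < c
      0<c = to (realises 0) ([] , ([] , []) , [] , refl)

  -- Only the empty decomposition uses no index, so a₀ = 1.
  a-zero : a 0 ≡ 1
  a-zero = a-mex 0 1 λ z → mk⇔ only-empty (λ { (s≤s z≤n) → [] , ([] , []) , [] , refl })
    where
      only-empty : ∀ {z} → HasLegalDecompUsing m a 0 z → z < 1
      only-empty ([] , _ , _ , refl) = s≤s z≤n
      only-empty (_ ∷ _ , _ , (() ∷ _) , _)

  a-from-enumeration : ∀ {i c E} → Enumerates i E → map val E ≡ upTo c → a (suc i) ≡ c
  a-from-enumeration {i} {c} {E} E-enum values = a-mex (suc i) c λ z → mk⇔ realised realisable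
    where
      realised : ∀ {z} → HasLegalDecompUsing m a (suc i) z → z < c
      realised (ℓ , legal , below , refl) =
        ∈-upTo⁻ (subst (val ℓ ∈_) values (∈-map⁺ val (complete E-enum (legal , All.map ≤-pred below))))
      realisable : ∀ {z} → z < c → HasLegalDecompUsing m a (suc i) z
      realisable z<c with ∈-map⁻ val (subst (_ ∈_) (sym values) (∈-upTo⁺ z<c))
      ... | ℓ , ℓ∈E , refl with sound E-enum ℓ∈E
      ...   | legal , below = ℓ , legal , All.map s≤s below , refl

  -- If E enumerates the decompositions supported below m·k and has values
  -- 0, …, c−1, then a_{mk+j} = j·c, so that extend k j E has values 0, …, (j+1)c−1.
  extend-values : ∀ {k c E} j → j ≤ m → Enumerates (m * k) E → map val E ≡ upTo c →
                  map val (extend k j E) ≡ upTo (suc j * c)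
  extend-values {c = c} zero _ _ values = trans values (cong upTo (sym (+-identityʳ c)))
  extend-values {k} {c} {E} (suc j) j<m E-enum values = begin
    map val (extend k j E ++ map (_∷ʳ top) E)
      ≡⟨ map-++ val (extend k j E) _ ⟩
    map val (extend k j E) ++ map val (map (_∷ʳ top) E)
      ≡⟨ cong₂ _++_ previous new ⟩
    upTo (suc j * c) ++ applyUpTo (suc j * c +_) c
      ≡⟨ applyUpTo-+ id (suc j * c) c ⟨
    upTo (suc j * c + c)
      ≡⟨ cong upTo (+-comm (suc j * c) c) ⟩
    upTo (suc (suc j) * c) ∎
    where
      open ≡-Reasoning
      top : ℕ
      top = m * k + suc j
      previous : map val (extend k j E) ≡ upTo (suc j * c)
      previous = extend-values j (<⇒≤ j<m) E-enum values
      a-top : a top ≡ suc j * c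
      a-top = subst (λ i → a i ≡ suc j * c) (sym (+-suc (m * k) j))
                    (a-from-enumeration (extend-enumerates j (<⇒≤ j<m) E-enum) previous)
      new : map val (map (_∷ʳ top) E) ≡ applyUpTo (suc j * c +_) c
      new = begin
        map val (map (_∷ʳ top) E)        ≡⟨ map-∘ E ⟨
        map (val ∘ (_∷ʳ top)) E          ≡⟨ map-cong (λ ℓ → trans (value-∷ʳ ℓ top) (cong (_+ val ℓ) a-top)) E ⟩
        map ((suc j * c +_) ∘ val) E     ≡⟨ map-∘ E ⟩
        map (suc j * c +_) (map val E)   ≡⟨ cong (map (suc j * c +_)) values ⟩
        map (suc j * c +_) (upTo c)      ≡⟨ map-upTo (suc j * c +_) c ⟩
        applyUpTo (suc j * c +_) c ∎

  enum-values : ∀ k → map val (Enum k) ≡ upTo (N m k)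
  enum-values zero = cong (λ v → 0 ∷ v ∷ []) (trans (+-identityʳ (a 0)) a-zero)
  enum-values (suc k) = extend-values m ≤-refl (enum-enumerates k) (enum-values k)

  a-block-start : ∀ n → a (m * n + 1) ≡ N m n
  a-block-start n = trans (cong a (+-comm (m * n) 1)) (a-from-enumeration (enum-enumerates n) (enum-values n))

  -- a is strictly increasing: a_{i+1} = a_i would make [i] a decomposition of
  -- a_{i+1}, and a_{i+1} < a_i would give one by the minimality of a_i.
  a-step : ∀ i → a i < a (suc i)
  a-step i with isMGonal i | isMGonal (suc i) | <-cmp (a i) (a (suc i))
  ... | _ | _ | tri< ai<ai+1 _ _ = ai<ai+1
  ... | _ | _ , undecomposable , _ | tri≈ _ ai≡ai+1 _ =
    ⊥-elim (undecomposable ([ i ] , ([] ∷ [] , [] ∷ []) , (≤-refl ∷ []) , trans (+-identityʳ (a i)) ai≡ai+1))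
  ... | _ , _ , minimal | positive , undecomposable , _ | tri> _ _ ai+1<ai
    with ℓ , legal , below , value≡ ← minimal (a (suc i)) positive ai+1<ai =
    ⊥-elim (undecomposable (ℓ , legal , All.map m<n⇒m<1+n below , value≡))

  a-monotone : ∀ {i j} → i ≤ j → a i ≤ a j
  a-monotone = monotone′ ∘ ≤⇒≤′
    where
      monotone′ : ∀ {i j} → i ≤′ j → a i ≤ a j
      monotone′ ≤′-refl = ≤-refl
      monotone′ (≤′-step i≤′j) = ≤-trans (monotone′ i≤′j) (<⇒≤ (a-step _))

  indices-below : ∀ {i} ℓ → val ℓ < a (suc i) → All (_≤ i) ℓ
  indices-below ℓ small = All.tabulate λ x∈ℓ → ≮⇒≥ λ i<x →
    <⇒≱ small (≤-trans (a-monotone i<x) (∈⇒≤sum (∈-map⁺ a x∈ℓ)))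

  small-decompositions : ∀ n s z →
    z ∈ map val (ofLength s (Enum n)) ⇔ (z < a (m * n + 1) × DecompHasSummands m a s z)
  small-decompositions n s z = mk⇔ listed unlisted
    where
      listed : z ∈ map val (ofLength s (Enum n)) → z < a (m * n + 1) × DecompHasSummands m a s z
      listed z∈ with ∈-map⁻ val z∈
      ... | ℓ , ℓ∈ , refl with ∈-filter⁻ (λ ℓ → length ℓ ≟ s) ℓ∈
      ...   | ℓ∈Enum , length≡s =
        subst (val ℓ <_) (sym (a-block-start n)) (∈-upTo⁻ (subst (val ℓ ∈_) (enum-values n) (∈-map⁺ val ℓ∈Enum)))
        , ℓ , proj₁ (sound (enum-enumerates n) ℓ∈Enum) , length≡s , refl
      unlisted : z < a (m * n + 1) × DecompHasSummands m a s z → z ∈ map val (ofLength s (Enum n))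
      unlisted (z< , ℓ , legal , length≡s , refl) =
        ∈-map⁺ val (∈-filter⁺ (λ ℓ → length ℓ ≟ s) (complete (enum-enumerates n) (legal , below)) length≡s)
        where
          below : All (_≤ m * n) ℓ
          below = indices-below ℓ (subst (λ i → val ℓ < a i) (+-comm (m * n) 1) z<)

  -- These values are distinct, since all values of Enum n are.
  distinct-values : ∀ n s → Unique (map val (ofLength s (Enum n)))
  distinct-values n s = AllPairsP.map⁺ (AllPairsP.filter⁺ (λ ℓ → length ℓ ≟ s)
    (AllPairsP.map⁻ (subst Unique (sym (enum-values n)) (upTo⁺ (N m n)))))

proposition2p6 : (m : ℕ) → 1 ≤ m → (a : ℕ → ℕ) → IsMGonal m a → (n k : ℕ) →
    Σ (List ℕ) λ L → Unique L
      × (∀ z → (z ∈ L) ⇔ (z < a (m * n + 1) × DecompHasSummands m a k z))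
      × (k ≡ 0 → length L ≡ 1)
      × (1 ≤ k → k ≤ n + 1 → length L ≡ m ^ k * (n C k) + m ^ (k ∸ 1) * (n C (k ∸ 1)))
      × (n + 1 < k → length L ≡ 0)
proposition2p6 m _ a isMGonal n k =
    L
  , distinct-values n k
  , small-decompositions n k
  , (λ k≡0 → trans length-L (cong (p n) k≡0))
  , (λ 1≤k _ → trans length-L (p-formula n k 1≤k))
  , (λ n+1<k → trans length-L (p-vanishes n k n+1<k))
  where
    open Enumeration m
    open Counting m
    open MGonal m a isMGonal

    L : List ℕ
    L = map val (ofLength k (Enum n))

    length-L : length L ≡ p n k
    length-L = trans (length-map val (ofLength k (Enum n))) (count-enum n k)
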